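{- Let $(\mathcal{P}^{(l)})_{l\geq 1}$ be a sequence of packing arrays, $\mathcal{P}^{(l)}$ a PA$(n_l;t_l,k_l,v_l)$ with $t_l\ge 2$, such that $n_l\leq n_{l+1}$, $t_l\leq t_{l+1}$, $k_l\leq k_{l+1}$, $v_l\leq v_{l+1}$ and \[\mathcal{P}^{(l+1)}=\begin{pmatrix}\mathcal{P}^{(l)} & Y\\ Z& W\end{pmatrix}\] for some arrays $Y,Z,W$. Let $(d_l)_{l\ge1}$ be positive integers with $d_l\leq\frac{k_l-1}{t_l-1}$ and $d_l\leq d_{l+1}$ for all $l\geq 1$. Then there exists an embedding family $(\mathcal{M}^{(l)})_{l\ge1}$ in which $\mathcal{M}^{(l)}$ is the incidence matrix of a $d_l$-CFF$(k_l v_l,\, n_l)$.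
   Context: A packing array PA$(n;t,k,v)$ is an $n\times k$ array with entries from an alphabet of $v$ symbols such that in any $t$ columns every $t$-tuple of symbols occurs in at most one row (the symbol alphabets are nested along the sequence). A $d$-CFF$(t,n)$ is a set system with $t$ points and $n$ blocks in which no block is contained in the union of any $d$ other blocks, represented by its $t\times n$ binary incidence matrix. An embedding family is a sequence $(\mathcal{M}^{(l)})_l$ of incidence matrices of set systems $(X_l,\mathcal{B}_l)$, $\mathcal{M}^{(l)}$ a $d(l)$-CFF, with $X_l\subseteq X_{l+1}$, nondecreasing numbers of rows and columns, $d(l)\le d(l+1)$, and $\mathcal{M}^{(l+1)}=\begin{pmatrix}\mathcal{M}^{(l)}&Y'\\ Z'&W'\end{pmatrix}$ for some matrices $Y',Z',W'$. -}

module Defs where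

open import Data.Nat using (ℕ; _≤_; _<_; _*_; _∸_)
open import Data.Fin using (Fin; toℕ)
open import Data.Bool using (Bool; true; false)
open import Data.Product using (Σ; _×_; ∃)
open import Relation.Binary.PropositionalEquality using (_≡_; _≢_)
open import Function.Definitions using (Injective)

Matrix : Set → ℕ → ℕ → Set
Matrix A r c = Fin r → Fin c → A

IsTopLeftBlock : {A : Set} {r c r' c' : ℕ} → Matrix A r c → Matrix A r' c' → Set
IsTopLeftBlock {A} {r} {c} {r'} {c'} M M' =
  r ≤ r' × c ≤ c' ×
  (∀ (i : Fin r) (j : Fin c) (i' : Fin r') (j' : Fin c') →
     toℕ i ≡ toℕ i' → toℕ j ≡ toℕ j' → M i j ≡ M' i' j')

-- Packing array PA(n; t, k, v): an n × k array over the alphabet {0,…,v-1}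
-- (symbols as natural numbers, so alphabets are nested) such that in any
-- t (distinct) columns, every t-tuple of symbols occurs in at most one row.
IsPackingArray : (n t k v : ℕ) → Matrix ℕ n k → Set
IsPackingArray n t k v P =
  (∀ (i : Fin n) (j : Fin k) → P i j < v) ×
  (∀ (cols : Fin t → Fin k) → Injective _≡_ _≡_ cols →
     ∀ (r r' : Fin n) → (∀ (a : Fin t) → P r (cols a) ≡ P r' (cols a)) → r ≡ r')

-- d-CFF(t, n), given by its t × n binary incidence matrix (rows = points,
-- columns = blocks): no block is contained in the union of any d other blocks.
IsCFF : (d t n : ℕ) → Matrix Bool t n → Set
IsCFF d t n M =
  ∀ (j : Fin n) (S : Fin d → Fin n) → Injective _≡_ _≡_ S → (∀ (a : Fin d) → S a ≢ j) →
    ∃ λ (i : Fin t) → M i j ≡ true × (∀ (a : Fin d) → M i (S a) ≡ false)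

IsEmbeddingFamily : (r c dd : ℕ → ℕ) → ((l : ℕ) → Matrix Bool (r l) (c l)) → Set
IsEmbeddingFamily r c dd M =
  (∀ l → IsCFF (dd l) (r l) (c l) (M l)) ×
  (∀ l → r l ≤ r (Data.Nat.suc l)) ×
  (∀ l → c l ≤ c (Data.Nat.suc l)) ×
  (∀ l → dd l ≤ dd (Data.Nat.suc l)) ×
  (∀ l → IsTopLeftBlock (M l) (M (Data.Nat.suc l)))

module Submission where

-- Points are pairs (column j, symbol s) of the packing array, and block r is
-- {(j , P r j) | j < k}. Two distinct rows of a PA(n; t, k, v) agree in at most t - 1
-- columns, so d other rows together agree with row r in at most d(t - 1) < k columns;
-- at a remaining column j the point (j , P r j) lies in block r and in none of the
-- others. For the embedding property the points of level l are numbered so as to extend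
-- the numbering of level l - 1: the old k·v points keep their numbers, followed by the
-- new symbols of old columns (j < k, v ≤ s < v'), then by the new columns (k ≤ j < k').

open import Defs
open import Data.Bool using (Bool)
open import Data.Fin using (Fin; zero; suc; toℕ; fromℕ<; inject≤; combine)
open import Data.Fin.Properties
  using (any?; all?; ¬∀⟶∃¬; suc-injective; toℕ-injective; toℕ<n; toℕ-fromℕ<; fromℕ<-injective;
         toℕ-inject≤; toℕ-combine; combine-injective)
open import Data.Nat using (ℕ; zero; suc; _+_; _*_; _∸_; _≤_; _<_; z≤n; s≤s; s≤s⁻¹)
open import Data.Nat.Properties hiding (suc-injective)
open import Data.Product using (∃; _×_; _,_; proj₁; proj₂; curry)
open import Data.Product.Properties using (,-injectiveˡ; ,-injectiveʳ)
open import Data.Vec.Functional using (Vector; tail; _∷_)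
open import Function using (_∘_)
open import Function.Bundles using (mk⇔)
open import Function.Definitions using (Injective)
open import Relation.Nullary using (Dec; yes; no; does; ¬_; ¬?; contradiction; _×-dec_)
open import Relation.Nullary.Decidable using (decidable-stable; dec-true; dec-false; does-⇔)
open import Relation.Unary using (Pred; Decidable)
open import Relation.Binary.PropositionalEquality
open import Algebra.Properties.CommutativeMonoid.Sum +-0-commutativeMonoid using (sum; ∑-comm)

𝟙 : ∀ {a} {A : Set a} → Dec A → ℕ
𝟙 (yes _) = 1
𝟙 (no _)  = 0

𝟙-yes : ∀ {a} {A : Set a} (a? : Dec A) → A → 𝟙 a? ≡ 1
𝟙-yes (yes _) _ = refl
𝟙-yes (no ¬a) a = contradiction a ¬a

count : ∀ {n p} {P : Pred (Fin n) p} → Decidable P → ℕ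
count P? = sum (𝟙 ∘ P?)

sum-mono-≤ : ∀ {n} {f g : Vector ℕ n} → (∀ i → f i ≤ g i) → sum f ≤ sum g
sum-mono-≤ {zero}  _   = z≤n
sum-mono-≤ {suc n} f≤g = +-mono-≤ (f≤g zero) (sum-mono-≤ (f≤g ∘ suc))

term≤sum : ∀ {n} (f : Vector ℕ n) i → f i ≤ sum f
term≤sum f zero    = m≤m+n (f zero) (sum (tail f))
term≤sum f (suc i) = ≤-trans (term≤sum (tail f) i) (m≤n+m _ (f zero))

sum-const : ∀ n m → sum {n} (λ _ → m) ≡ n * m
sum-const zero    m = refl
sum-const (suc n) m = cong (m +_) (sum-const n m)

module _ {d k p} {Q : Fin d → Pred (Fin k) p} (Q? : ∀ a → Decidable (Q a)) where

  covered⇒≤ : ∀ {m} → (∀ a → count (Q? a) ≤ m) → (∀ j → ∃ λ a → Q a j) → k ≤ d * m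
  covered⇒≤ {m} sparse covered = begin
    k                                  ≡⟨ sym (*-identityʳ k) ⟩
    k * 1                              ≡⟨ sym (sum-const k 1) ⟩
    sum {k} (λ _ → 1)                  ≤⟨ sum-mono-≤ hit ⟩
    sum (λ j → sum (λ a → 𝟙 (Q? a j))) ≡⟨ ∑-comm (λ j a → 𝟙 (Q? a j)) ⟩
    sum (λ a → count (Q? a))           ≤⟨ sum-mono-≤ sparse ⟩
    sum {d} (λ _ → m)                  ≡⟨ sum-const d m ⟩
    d * m                              ∎
    where
    open ≤-Reasoning
    hit : ∀ j → 1 ≤ sum (λ a → 𝟙 (Q? a j))
    hit j with a , q ← covered j
      = ≤-trans (≤-reflexive (sym (𝟙-yes (Q? a j) q))) (term≤sum (λ a → 𝟙 (Q? a j)) a)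

  sparse⇒uncovered : ∀ {m} → (∀ a → count (Q? a) ≤ m) → d * m < k → ∃ λ j → ∀ a → ¬ Q a j
  sparse⇒uncovered sparse dm<k with any? (λ j → all? (λ a → ¬? (Q? a j)))
  ... | yes found = found
  ... | no none = contradiction (covered⇒≤ sparse covered) (<⇒≱ dm<k)
    where
    covered : ∀ j → ∃ λ a → Q a j
    covered j with a , ¬¬q ← ¬∀⟶∃¬ d _ (λ a → ¬? (Q? a j)) (λ all¬ → none (j , all¬))
      = a , decidable-stable (Q? a j) ¬¬q

zero∷suc-injective : ∀ {t n} {g : Fin t → Fin n} → Injective _≡_ _≡_ g →
  Injective _≡_ _≡_ (zero ∷ suc ∘ g)
zero∷suc-injective g-inj {zero}  {zero}  _  = refl
zero∷suc-injective g-inj {suc x} {suc y} eq = cong suc (g-inj (suc-injective eq))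

dense⇒injection : ∀ {n t p} {P : Pred (Fin n) p} (P? : Decidable P) → t ≤ count P? →
  ∃ λ (g : Fin t → Fin n) → Injective _≡_ _≡_ g × (∀ x → P (g x))
dense⇒injection {t = zero} P? _ = (λ ()) , (λ { {()} }) , λ ()
dense⇒injection {zero} {suc t} P? ()
dense⇒injection {suc n} {suc t} P? t≤c with P? zero
... | yes p₀ with g , g-inj , g∈P ← dense⇒injection (P? ∘ suc) (s≤s⁻¹ t≤c)
  = zero ∷ suc ∘ g , zero∷suc-injective g-inj , λ { zero → p₀ ; (suc x) → g∈P x }
... | no _ with g , g-inj , g∈P ← dense⇒injection (P? ∘ suc) t≤c
  = suc ∘ g , g-inj ∘ suc-injective , g∈P

record InjectsInto {X : Set} (D : X → Set) (N : ℕ) (f : X → ℕ) : Set where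
  field
    bounded   : ∀ {x} → D x → f x < N
    injective : ∀ {x y} → D x → D y → f x ≡ f y → x ≡ y

open InjectsInto

resize : ∀ {X} {D : X → Set} {N N' f} → N ≡ N' → InjectsInto D N f → InjectsInto D N' f
resize refl f-inj = f-inj

module _ {X : Set} {A : X → Set} (A? : Decidable A) where

  splice : (X → ℕ) → ℕ → (X → ℕ) → X → ℕ
  splice f a g x with A? x
  ... | yes _ = f x
  ... | no  _ = a + g x

  module _ {f g : X → ℕ} {a : ℕ} where

    splice-inside : ∀ {x} → A x → splice f a g x ≡ f x
    splice-inside {x} ax with A? x
    ... | yes _  = refl
    ... | no ¬ax = contradiction ax ¬ax

    splice-outside : ∀ {x} → ¬ A x → a ≤ splice f a g x
    splice-outside {x} ¬ax with A? x
    ... | yes ax = contradiction ax ¬ax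
    ... | no _   = m≤m+n a (g x)

    splice-injects : ∀ {B D : X → Set} {b} → InjectsInto A a f → InjectsInto B b g →
      (∀ {x} → D x → ¬ A x → B x) → InjectsInto D (a + b) (splice f a g)
    splice-injects {D = D} {b} f-inj g-inj D∖A⊆B = record { bounded = bound ; injective = inj }
      where
      bound : ∀ {x} → D x → splice f a g x < a + b
      bound {x} dx with A? x
      ... | yes ax  = ≤-trans (bounded f-inj ax) (m≤m+n a b)
      ... | no  ¬ax = +-monoʳ-< a (bounded g-inj (D∖A⊆B dx ¬ax))
      inside<outside : ∀ {x} → A x → ∀ y → f x < a + g y
      inside<outside ax y = <-≤-trans (bounded f-inj ax) (m≤m+n a (g y))
      inj : ∀ {x y} → D x → D y → splice f a g x ≡ splice f a g y → x ≡ y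
      inj {x} {y} dx dy eq with A? x | A? y
      ... | yes ax  | yes ay  = injective f-inj ax ay eq
      ... | yes ax  | no  _   = contradiction eq (<⇒≢ (inside<outside ax y))
      ... | no  _   | yes ay  = contradiction (sym eq) (<⇒≢ (inside<outside ay x))
      ... | no  ¬ax | no  ¬ay =
        injective g-inj (D∖A⊆B dx ¬ax) (D∖A⊆B dy ¬ay) (+-cancelˡ-≡ a (g x) (g y) eq)

Rect : ℕ → ℕ → ℕ × ℕ → Set
Rect k v x = proj₁ x < k × proj₂ x < v

rect? : ∀ k v → Decidable (Rect k v)
rect? k v x = proj₁ x <? k ×-dec proj₂ x <? v

Box : ℕ → ℕ → ℕ → ℕ → ℕ × ℕ → Set
Box j₀ j₁ s₀ s₁ x = (j₀ ≤ proj₁ x × proj₁ x < j₁) × (s₀ ≤ proj₂ x × proj₂ x < s₁)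

boxCode : ℕ → ℕ → ℕ → ℕ × ℕ → ℕ
boxCode j₀ s₀ w (j , s) = w * (j ∸ j₀) + (s ∸ s₀)

radix-injects : ∀ {a w} → InjectsInto (Rect a w) (a * w) (λ (j , s) → w * j + s)
radix-injects {a} {w} = record { bounded = bound ; injective = inj }
  where
  digits : ∀ {j s} → Rect a w (j , s) → Fin (a * w)
  digits (j<a , s<w) = combine (fromℕ< j<a) (fromℕ< s<w)
  toℕ-digits : ∀ {j s} (r : Rect a w (j , s)) → toℕ (digits r) ≡ w * j + s
  toℕ-digits {j} {s} (j<a , s<w) = begin
    toℕ (combine (fromℕ< j<a) (fromℕ< s<w))  ≡⟨ toℕ-combine (fromℕ< j<a) (fromℕ< s<w) ⟩
    w * toℕ (fromℕ< j<a) + toℕ (fromℕ< s<w)  ≡⟨ cong₂ (λ x y → w * x + y) (toℕ-fromℕ< j<a)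
                                                                       (toℕ-fromℕ< s<w) ⟩
    w * j + s                                ∎
    where open ≡-Reasoning
  bound : ∀ {x} → Rect a w x → _ < a * w
  bound r = subst (_< a * w) (toℕ-digits r) (toℕ<n (digits r))
  inj : ∀ {x y} → Rect a w x → Rect a w y → _ ≡ _ → x ≡ y
  inj {j , s} {j' , s'} r@(j<a , s<w) r'@(j'<a , s'<w) eq
    with combine-injective (fromℕ< j<a) (fromℕ< s<w) (fromℕ< j'<a) (fromℕ< s'<w)
           (toℕ-injective (trans (toℕ-digits r) (trans eq (sym (toℕ-digits r')))))
  ... | j≡j' , s≡s' =
    cong₂ _,_ (fromℕ<-injective j j' j<a j'<a j≡j') (fromℕ<-injective s s' s<w s'<w s≡s')

boxCode-injects : ∀ {j₀ j₁ s₀ s₁} →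
  InjectsInto (Box j₀ j₁ s₀ s₁) ((j₁ ∸ j₀) * (s₁ ∸ s₀)) (boxCode j₀ s₀ (s₁ ∸ s₀))
boxCode-injects {j₀} {j₁} {s₀} {s₁} = record
  { bounded   = λ b → bounded radix-injects (shift b)
  ; injective = λ b b' eq → unshift b b' (injective radix-injects (shift b) (shift b') eq)
  }
  where
  shift : ∀ {j s} → Box j₀ j₁ s₀ s₁ (j , s) → Rect (j₁ ∸ j₀) (s₁ ∸ s₀) (j ∸ j₀ , s ∸ s₀)
  shift ((j₀≤j , j<j₁) , (s₀≤s , s<s₁)) = ∸-monoˡ-< j<j₁ j₀≤j , ∸-monoˡ-< s<s₁ s₀≤s
  unshift : ∀ {j s j' s'} → Box j₀ j₁ s₀ s₁ (j , s) → Box j₀ j₁ s₀ s₁ (j' , s') →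
    (j ∸ j₀ , s ∸ s₀) ≡ (j' ∸ j₀ , s' ∸ s₀) → (j , s) ≡ (j' , s')
  unshift ((j₀≤j , _) , (s₀≤s , _)) ((j₀≤j' , _) , (s₀≤s' , _)) eq =
    cong₂ _,_ (∸-cancelʳ-≡ j₀≤j j₀≤j' (,-injectiveˡ eq)) (∸-cancelʳ-≡ s₀≤s s₀≤s' (,-injectiveʳ eq))

widenSymbols : ℕ → ℕ → ℕ → (ℕ × ℕ → ℕ) → ℕ × ℕ → ℕ
widenSymbols k v v' c = splice (rect? k v) c (k * v) (boxCode 0 v (v' ∸ v))

widenColumns : ℕ → ℕ → ℕ → (ℕ × ℕ → ℕ) → ℕ × ℕ → ℕ
widenColumns k k' v' c = splice (rect? k v') c (k * v') (boxCode k 0 v')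

widenSymbols-injects : ∀ {k v v' c} → v ≤ v' → InjectsInto (Rect k v) (k * v) c →
  InjectsInto (Rect k v') (k * v') (widenSymbols k v v' c)
widenSymbols-injects {k} {v} {v'} v≤v' c-inj =
  resize size (splice-injects (rect? k v) c-inj boxCode-injects new-symbols)
  where
  size : k * v + k * (v' ∸ v) ≡ k * v'
  size = trans (sym (*-distribˡ-+ k v (v' ∸ v))) (cong (k *_) (m+[n∸m]≡n v≤v'))
  new-symbols : ∀ {x} → Rect k v' x → ¬ Rect k v x → Box 0 k v v' x
  new-symbols (j<k , s<v') ¬old = (z≤n , j<k) , (≮⇒≥ (λ s<v → ¬old (j<k , s<v)) , s<v')

widenColumns-injects : ∀ {k k' v' c} → k ≤ k' → InjectsInto (Rect k v') (k * v') c →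
  InjectsInto (Rect k' v') (k' * v') (widenColumns k k' v' c)
widenColumns-injects {k} {k'} {v'} k≤k' c-inj =
  resize size (splice-injects (rect? k v') c-inj boxCode-injects new-columns)
  where
  size : k * v' + (k' ∸ k) * v' ≡ k' * v'
  size = trans (sym (*-distribʳ-+ v' k (k' ∸ k))) (cong (_* v') (m+[n∸m]≡n k≤k'))
  new-columns : ∀ {x} → Rect k' v' x → ¬ Rect k v' x → Box k k' 0 v' x
  new-columns (j<k' , s<v') ¬old = (≮⇒≥ (λ j<k → ¬old (j<k , s<v')) , j<k') , (z≤n , s<v')

extend : ℕ → ℕ → ℕ → ℕ → (ℕ × ℕ → ℕ) → ℕ × ℕ → ℕ
extend k v k' v' = widenColumns k k' v' ∘ widenSymbols k v v'

module _ {k v k' v' : ℕ} (k≤k' : k ≤ k') (v≤v' : v ≤ v') {c : ℕ × ℕ → ℕ} where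

  extend-injects : InjectsInto (Rect k v) (k * v) c →
    InjectsInto (Rect k' v') (k' * v') (extend k v k' v' c)
  extend-injects = widenColumns-injects k≤k' ∘ widenSymbols-injects v≤v'

  extend-inside : ∀ {x} → Rect k v x → extend k v k' v' c x ≡ c x
  extend-inside old@(j<k , s<v) = trans (splice-inside (rect? k v') (j<k , <-≤-trans s<v v≤v'))
                                        (splice-inside (rect? k v) old)

  extend-outside : ∀ {x} → ¬ Rect k v x → k * v ≤ extend k v k' v' c x
  extend-outside {x} ¬old = by-cases (rect? k v' x)
    where
    by-cases : Dec (Rect k v' x) → k * v ≤ extend k v k' v' c x
    by-cases (yes mid) = subst (k * v ≤_) (sym (splice-inside (rect? k v') mid))
                           (splice-outside (rect? k v) ¬old)
    by-cases (no ¬mid) = ≤-trans (*-monoʳ-≤ k v≤v') (splice-outside (rect? k v') ¬mid)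

levelCode : (k v : ℕ → ℕ) → ℕ → ℕ × ℕ → ℕ
levelCode k v zero    = extend 0 0 (k 0) (v 0) (λ _ → 0)
levelCode k v (suc l) = extend (k l) (v l) (k (suc l)) (v (suc l)) (levelCode k v l)

levelCode-injects : ∀ {k v : ℕ → ℕ} → (∀ l → k l ≤ k (suc l)) → (∀ l → v l ≤ v (suc l)) →
  ∀ l → InjectsInto (Rect (k l) (v l)) (k l * v l) (levelCode k v l)
levelCode-injects _ _ zero =
  extend-injects z≤n z≤n {c = λ _ → 0} (record { bounded = λ () ; injective = λ () })
levelCode-injects k-mono v-mono (suc l) =
  extend-injects (k-mono l) (v-mono l) (levelCode-injects k-mono v-mono l)

module _ {n k : ℕ} (code : ℕ × ℕ → ℕ) (P : Matrix ℕ n k) where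

  Incident : ℕ → Fin n → Set
  Incident x r = ∃ λ j → x ≡ code (toℕ j , P r j)

  incident? : ∀ x r → Dec (Incident x r)
  incident? x r = any? λ j → x ≟ code (toℕ j , P r j)

incidence : ∀ {n k} (N : ℕ) → (ℕ × ℕ → ℕ) → Matrix ℕ n k → Matrix Bool N n
incidence N code P i r = does (incident? code P (toℕ i) r)

distinct-rows-agree≤ : ∀ {n t k v P} → IsPackingArray n t k v P → ∀ {r r'} → r ≢ r' →
  count (λ j → P r j ≟ P r' j) ≤ t ∸ 1
distinct-rows-agree≤ {t = t} {P = P} (_ , packing) {r} {r'} r≢r'
  with t ≤? count (λ j → P r j ≟ P r' j)
... | yes t≤c with cols , cols-inj , agree ← dense⇒injection _ t≤c
  = contradiction (packing cols cols-inj r r' agree) r≢r'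
... | no t≰c = ∸-monoˡ-≤ 1 (≰⇒> t≰c)

incidence-isCFF : ∀ {n t k v d N code P} → IsPackingArray n t k v P →
  InjectsInto (Rect k v) N code → d * (t ∸ 1) < k → IsCFF d N n (incidence N code P)
-- The union bound does not need the blocks S a to be distinct.
incidence-isCFF {N = N} {code} {P} isPA@(P<v , _) code-inj dt<k r S _ S≢r =
  point , dec-true (incident? code P _ r) (col , toℕ-point) ,
  λ a → dec-false (incident? code P _ (S a)) (missed a)
  where
  fresh-column : ∃ λ j → ∀ a → P r j ≢ P (S a) j
  fresh-column = sparse⇒uncovered (λ a j → P r j ≟ P (S a) j)
                   (λ a → distinct-rows-agree≤ isPA (S≢r a ∘ sym)) dt<k
  col = proj₁ fresh-column
  point-bound : code (toℕ col , P r col) < N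
  point-bound = bounded code-inj (toℕ<n col , P<v r col)
  point : Fin N
  point = fromℕ< point-bound
  toℕ-point : toℕ point ≡ code (toℕ col , P r col)
  toℕ-point = toℕ-fromℕ< point-bound
  missed : ∀ a → ¬ Incident code P (toℕ point) (S a)
  missed a (j , eq) = proj₂ fresh-column a (trans (,-injectiveʳ same) (cong (P (S a)) (sym col≡j)))
    where
    same : (toℕ col , P r col) ≡ (toℕ j , P (S a) j)
    same = injective code-inj (toℕ<n col , P<v r col) (toℕ<n j , P<v (S a) j)
             (trans (sym toℕ-point) eq)
    col≡j : col ≡ j
    col≡j = toℕ-injective (,-injectiveˡ same)

incidence-isTopLeftBlock : ∀ {n k n' k' v N N'} {code code' : ℕ × ℕ → ℕ}
  {P : Matrix ℕ n k} {P' : Matrix ℕ n' k'} →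
  (∀ r j → P r j < v) → IsTopLeftBlock P P' → N ≤ N' →
  (∀ {x} → Rect k v x → code' x ≡ code x) → (∀ {x} → ¬ Rect k v x → N ≤ code' x) →
  IsTopLeftBlock (incidence N code P) (incidence N' code' P')
incidence-isTopLeftBlock {k = k} {v = v} {code = code} {code'} {P} {P'}
  P<v (n≤n' , k≤k' , P≡P') N≤N' inside outside = N≤N' , n≤n' , same-entries
  where
  same-entries : ∀ i r i' r' → toℕ i ≡ toℕ i' → toℕ r ≡ toℕ r' →
    incidence _ code P i r ≡ incidence _ code' P' i' r'
  same-entries i r i' r' i≡i' r≡r' =
    does-⇔ (mk⇔ old⇒new new⇒old) (incident? code P _ r) (incident? code' P' _ r')
    where
    old⇒new : Incident code P (toℕ i) r → Incident code' P' (toℕ i') r'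
    old⇒new (j , eq) = j' , (begin
      toℕ i'                     ≡⟨ trans (sym i≡i') eq ⟩
      code (toℕ j , P r j)       ≡⟨ sym (inside (toℕ<n j , P<v r j)) ⟩
      code' (toℕ j , P r j)      ≡⟨ cong₂ (curry code') (sym toℕ-j') entry ⟩
      code' (toℕ j' , P' r' j')  ∎)
      where
      open ≡-Reasoning
      j' = inject≤ j k≤k'
      toℕ-j' : toℕ j' ≡ toℕ j
      toℕ-j' = toℕ-inject≤ j k≤k'
      entry : P r j ≡ P' r' j'
      entry = P≡P' r j r' j' r≡r' (sym toℕ-j')
    new⇒old : Incident code' P' (toℕ i') r' → Incident code P (toℕ i) r
    new⇒old (j' , eq) = j , (begin
      toℕ i                      ≡⟨ trans i≡i' eq ⟩
      code' (toℕ j' , P' r' j')  ≡⟨ cong₂ (curry code') (sym toℕ-j) (sym entry) ⟩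
      code' (toℕ j , P r j)      ≡⟨ inside (toℕ<n j , P<v r j) ⟩
      code (toℕ j , P r j)       ∎)
      where
      open ≡-Reasoning
      old-point : Rect k v (toℕ j' , P' r' j')
      old-point = decidable-stable (rect? k v _) λ ¬old →
        <⇒≱ (toℕ<n i) (subst (_ ≤_) (sym (trans i≡i' eq)) (outside ¬old))
      j = fromℕ< (proj₁ old-point)
      toℕ-j : toℕ j ≡ toℕ j'
      toℕ-j = toℕ-fromℕ< (proj₁ old-point)
      entry : P r j ≡ P' r' j'
      entry = P≡P' r j r' j' r≡r' toℕ-j

m≤n∸1⇒m<n : ∀ {m n} → 0 < m → m ≤ n ∸ 1 → m < n
m≤n∸1⇒m<n {n = zero}  0<m m≤0 = contradiction m≤0 (<⇒≱ 0<m)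
m≤n∸1⇒m<n {n = suc n} _   m≤n = s≤s m≤n

proposition4 : (n t k v d : ℕ → ℕ) → (P : (l : ℕ) → Matrix ℕ (n l) (k l))
    → (∀ l → IsPackingArray (n l) (t l) (k l) (v l) (P l))
    → (∀ l → 2 ≤ t l)
    → (∀ l → n l ≤ n (suc l)) → (∀ l → t l ≤ t (suc l))
    → (∀ l → k l ≤ k (suc l)) → (∀ l → v l ≤ v (suc l))
    → (∀ l → IsTopLeftBlock (P l) (P (suc l)))
    → (∀ l → 1 ≤ d l)
    → (∀ l → d l * (t l ∸ 1) ≤ k l ∸ 1)
    → (∀ l → d l ≤ d (suc l))
    → ∃ λ (M : (l : ℕ) → Matrix Bool (k l * v l) (n l)) →
        IsEmbeddingFamily (λ l → k l * v l) n d M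
proposition4 n t k v d P isPA 2≤t n-mono _ k-mono v-mono P-blocks 1≤d d-bound d-mono =
  M , (λ l → incidence-isCFF (isPA l) (levelCode-injects k-mono v-mono l) (dt<k l))
    , kv-mono , n-mono , d-mono
    , λ l → incidence-isTopLeftBlock (proj₁ (isPA l)) (P-blocks l) (kv-mono l)
              (extend-inside (k-mono l) (v-mono l)) (extend-outside (k-mono l) (v-mono l))
  where
  M : (l : ℕ) → Matrix Bool (k l * v l) (n l)
  M l = incidence (k l * v l) (levelCode k v l) (P l)
  kv-mono : ∀ l → k l * v l ≤ k (suc l) * v (suc l)
  kv-mono l = *-mono-≤ (k-mono l) (v-mono l)
  dt<k : ∀ l → d l * (t l ∸ 1) < k l
  dt<k l = m≤n∸1⇒m<n (*-mono-≤ (1≤d l) (∸-monoˡ-≤ 1 (2≤t l))) (d-bound l)
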